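{- For $\sigma\in\mathfrak S_n$, let $\overline\sigma=\sigma(n)\sigma(n-1)\cdots\sigma(1)$. Then $c_\sigma=(-1)^{n-1}c_{\overline\sigma}$.
   Context: ${\bf FQSym}$: basis $\mathbf G_\sigma$, $\sigma$ permutations viewed as words. For $\alpha\in\mathfrak S_k,\beta\in\mathfrak S_l$, $n=k+l$, $\gamma=uv\in\alpha\star\beta$ means $\gamma\in\mathfrak S_n$, $\gamma=uv$, $|u|=k$, ${\rm std}(u)=\alpha$, ${\rm std}(v)=\beta$. Define $\mathbf G_\alpha\nearrow\mathbf G_\beta=\sum_{\gamma=uv\in\alpha\star\beta,\,1\in u,\,n\in v}\mathbf G_\gamma$, $\mathbf G_\alpha\swarrow\mathbf G_\beta=\sum_{\gamma=uv\in\alpha\star\beta,\,1\in v,\,n\in u}\mathbf G_\gamma$ (bilinearly, in positive degrees), and $B(x,y)=x\nearrow y-y\swarrow x$. Let $a,b$ be parameters. Let $X=\mathbf G_1+X_+$ be the unique element of the degree-completion of ${\bf FQSym}\otimes\mathbb K[a,b]$ with $X_+$ of degree $\ge2$ satisfying $X_+=B(\mathbf G_1+aX_+,\ \mathbf G_1+bX_+)$, and write its degree-$n$ component as $X_n=\sum_{\sigma\in\mathfrak S_n}c_\sigma\mathbf G_\sigma$ (with $c_1=1$). -}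

module Defs where

open import Algebra.Bundles using (CommutativeRing)
open import Data.Nat using (ℕ; zero; suc; _∸_; _<?_; _≡ᵇ_)
open import Data.Bool using (Bool; true; false; if_then_else_; _∧_)
open import Data.List using (List; []; _∷_; map; filter; length; take; drop; foldr; upTo; allFin)
open import Data.Bool.ListAction using (any)
open import Data.Fin using (Fin; toℕ)
open import Data.Fin.Permutation using (Permutation′; _⟨$⟩ʳ_)

word : ∀ {n} → Permutation′ n → List ℕ
word {n} σ = map (λ i → suc (toℕ (σ ⟨$⟩ʳ i))) (allFin n)

-- Standardization of a word with distinct letters: each letter replaced by its rank.
std : List ℕ → List ℕ
std u = map (λ x → suc (length (filter (_<? x) u))) u

mem : ℕ → List ℕ → Bool
mem x u = any (λ y → y ≡ᵇ x) u

-- Coefficients c_σ of X = G₁ + X₊, X₊ = B(G₁ + a X₊, G₁ + b X₊), with values in an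
-- arbitrary commutative ring R containing the parameters a, b.
module Coeffs {c ℓ} (R : CommutativeRing c ℓ) (a b : CommutativeRing.Carrier R) where
  open CommutativeRing R

  sgn : ℕ → Carrier
  sgn zero = 1#
  sgn (suc n) = - sgn n

  sumR : List Carrier → Carrier
  sumR = foldr _+_ 0#

  -- degree-k component of G₁ + t X₊ is weight t k · X_k
  weight : Carrier → ℕ → Carrier
  weight t 1 = 1#
  weight t _ = t

  -- coefficient with fuel; cF (length w) w is the true coefficient
  cF : ℕ → List ℕ → Carrier
  cF zero w = 0#
  cF (suc f) [] = 0#
  cF (suc f) (x ∷ []) = 1#
  cF (suc f) w@(_ ∷ _ ∷ _) = sumR (map term (map suc (upTo (n ∸ 1))))
    where
    n : ℕ
    n = length w
    -- γ = uv, |u| = k: contribution of (G₁+aX₊)_k ↗ (G₁+bX₊)_{n-k}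
    -- minus contribution of (G₁+bX₊)_k ↙ (G₁+aX₊)_{n-k}
    term : ℕ → Carrier
    term k =
      (if mem 1 u ∧ mem n v
         then weight a k * weight b (n ∸ k) * (cF f (std u) * cF f (std v))
         else 0#)
      - (if mem 1 v ∧ mem n u
           then weight b k * weight a (n ∸ k) * (cF f (std u) * cF f (std v))
           else 0#)
      where
      u = take k w
      v = drop k w

  coeff : List ℕ → Carrier
  coeff w = cF (length w) w

-- Write γ = uv with |u| = k. Then γ̄ = v̄ū, and standardization and membership of 1 and n
-- commute with reversal, so the splitting of γ̄ at n − k has the ↗-condition of γ at k as its
-- ↙-condition and vice versa, with the weight factors exchanged. As B(x, y) = x ↗ y − y ↙ x,
-- this costs a sign −1, and by induction the two coefficient factors pick up (−1)^(k−1) and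
-- (−1)^(n−k−1). Each summand, hence c_γ̄, is thus (−1)^(n−1) times the summand of c_γ at k.
module Submission where

open import Defs
open import Algebra.Bundles using (CommutativeRing)
open import Data.Bool using (Bool; true; false; if_then_else_; _∧_)
open import Data.Bool.Properties using (∨-isCommutativeMonoid)
open import Data.Fin.Permutation using (Permutation′)
open import Data.List
  using (List; []; _∷_; _++_; map; filter; length; take; drop; reverse; upTo; applyUpTo; applyDownFrom; allFin)
open import Data.List.Properties
  using (length-map; length-reverse; length-drop; length-tabulate; map-cong; map-∘; map-upTo; map-applyUpTo;
         length-take; reverse-map; reverse-++; reverse-involutive; reverse-applyUpTo; take++drop≡id)
open import Data.List.Relation.Binary.Permutation.Propositional using (↭⇒↭ₛ)
open import Data.List.Relation.Binary.Permutation.Propositional.Properties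
  using (↭-length; ↭-reverse; filter-↭; map⁺)
import Data.List.Relation.Binary.Permutation.Setoid.Properties as PermutationProperties
open import Data.List.Relation.Unary.All using (All; []; _∷_)
open import Data.List.Relation.Unary.All.Properties using (applyUpTo⁺₁)
open import Data.Nat as ℕ using (ℕ; zero; suc; _∸_; _<_; _≤_; _<?_; _≡ᵇ_)
open import Data.Nat.Properties using (m+n∸n≡m; m+n∸m≡n; m+[n∸m]≡n; m≤n+m; m≤n⇒m⊓n≡m; +-suc)
open import Relation.Binary.PropositionalEquality as ≡ using (_≡_; cong; cong₂; subst; subst₂; module ≡-Reasoning)
import Relation.Binary.Reasoning.Setoid as SetoidReasoning

std-reverse : ∀ u → std (reverse u) ≡ reverse (std u)
std-reverse u = ≡.trans (map-cong rank-reverse (reverse u)) (reverse-map rank u)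
  where
  rank : ℕ → ℕ
  rank x = suc (length (filter (_<? x) u))
  rank-reverse : ∀ x → suc (length (filter (_<? x) (reverse u))) ≡ rank x
  rank-reverse x = cong suc (↭-length (filter-↭ (_<? x) (↭-reverse u)))

mem-reverse : ∀ x u → mem x (reverse u) ≡ mem x u
mem-reverse x u =
  foldr-commMonoid ∨-isCommutativeMonoid (↭⇒↭ₛ (map⁺ (λ y → y ≡ᵇ x) (↭-reverse u)))
  where open PermutationProperties (≡.setoid Bool) using (foldr-commMonoid)

take-length-++ : ∀ {ℓ} {A : Set ℓ} (xs ys : List A) → take (length xs) (xs ++ ys) ≡ xs
take-length-++ []       ys = ≡.refl
take-length-++ (x ∷ xs) ys = cong (x ∷_) (take-length-++ xs ys)

drop-length-++ : ∀ {ℓ} {A : Set ℓ} (xs ys : List A) → drop (length xs) (xs ++ ys) ≡ ys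
drop-length-++ []       ys = ≡.refl
drop-length-++ (x ∷ xs) ys = drop-length-++ xs ys

module _ {ℓ} {A : Set ℓ} (w : List A) (k j : ℕ) (k+j≡∣w∣ : k ℕ.+ j ≡ length w) where

  private
    reverse-take++drop : reverse w ≡ reverse (drop j w) ++ reverse (take j w)
    reverse-take++drop = ≡.trans (cong reverse (≡.sym (take++drop≡id j w))) (reverse-++ (take j w) (drop j w))

  length-drop-split : length (drop j w) ≡ k
  length-drop-split = ≡.trans (length-drop j w) (≡.trans (cong (_∸ j) (≡.sym k+j≡∣w∣)) (m+n∸n≡m k j))

  length-take-split : length (take j w) ≡ j
  length-take-split = ≡.trans (length-take j w) (m≤n⇒m⊓n≡m (subst (j ≤_) k+j≡∣w∣ (m≤n+m j k)))

  private
    length-reverse-drop : length (reverse (drop j w)) ≡ k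
    length-reverse-drop = ≡.trans (length-reverse (drop j w)) length-drop-split

  take-reverse : take k (reverse w) ≡ reverse (drop j w)
  take-reverse = begin
    take k (reverse w)
      ≡⟨ cong₂ take (≡.sym length-reverse-drop) reverse-take++drop ⟩
    take (length (reverse (drop j w))) (reverse (drop j w) ++ reverse (take j w))
      ≡⟨ take-length-++ (reverse (drop j w)) _ ⟩
    reverse (drop j w) ∎
    where open ≡-Reasoning

  drop-reverse : drop k (reverse w) ≡ reverse (take j w)
  drop-reverse = begin
    drop k (reverse w)
      ≡⟨ cong₂ drop (≡.sym length-reverse-drop) reverse-take++drop ⟩
    drop (length (reverse (drop j w))) (reverse (drop j w) ++ reverse (take j w))
      ≡⟨ drop-length-++ (reverse (drop j w)) _ ⟩
    reverse (take j w) ∎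
    where open ≡-Reasoning

applyUpTo-reverseIndex : ∀ {ℓ} {A : Set ℓ} (f : ℕ → A) m → applyUpTo (λ i → f (m ∸ suc i)) m ≡ applyDownFrom f m
applyUpTo-reverseIndex f zero    = ≡.refl
applyUpTo-reverseIndex f (suc m) = cong (f m ∷_) (applyUpTo-reverseIndex f m)

module _ {c ℓ} (R : CommutativeRing c ℓ) (a b : CommutativeRing.Carrier R) where

  open CommutativeRing R
  open Coeffs R a b
  open import Algebra.Properties.Ring ring using (-‿distribˡ-*; -‿distribʳ-*; x[y-z]≈xy-xz)
  open PermutationProperties setoid using (foldr-commMonoid) renaming (↭-reverse to ↭ₛ-reverse)
  open import Algebra.Properties.AbelianGroup +-abelianGroup using (⁻¹-anti-homo‿-)
  open import Algebra.Solver.CommutativeMonoid *-commutativeMonoid using (solve; _⊜_; _⊕_)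
  open SetoidReasoning setoid

  sgn-+ : ∀ m n → sgn (m ℕ.+ n) ≈ sgn m * sgn n
  sgn-+ zero    n = sym (*-identityˡ (sgn n))
  sgn-+ (suc m) n = trans (-‿cong (sgn-+ m n)) (-‿distribˡ-* (sgn m) (sgn n))

  sgn-+-suc : ∀ m n → sgn (m ℕ.+ suc n) ≈ - (sgn m * sgn n)
  sgn-+-suc m n = trans (sgn-+ m (suc n)) (sym (-‿distribʳ-* (sgn m) (sgn n)))

  sumR-reverse : ∀ xs → sumR (reverse xs) ≈ sumR xs
  sumR-reverse xs = foldr-commMonoid +-isCommutativeMonoid (↭ₛ-reverse xs)

  sumR-map-cong : ∀ {f g : ℕ → Carrier} {xs} → All (λ x → f x ≈ g x) xs → sumR (map f xs) ≈ sumR (map g xs)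
  sumR-map-cong []         = refl
  sumR-map-cong (fx≈gx ∷ p) = +-cong fx≈gx (sumR-map-cong p)

  *-distribˡ-sumR : ∀ s xs → s * sumR xs ≈ sumR (map (s *_) xs)
  *-distribˡ-sumR s []       = zeroʳ s
  *-distribˡ-sumR s (x ∷ xs) = trans (distribˡ s x (sumR xs)) (+-cong refl (*-distribˡ-sumR s xs))

  sumR-applyUpTo-reverseIndex : ∀ (g h : ℕ → Carrier) m → (∀ {i} → i < m → g i ≈ h (m ∸ suc i)) →
                                sumR (applyUpTo g m) ≈ sumR (applyUpTo h m)
  sumR-applyUpTo-reverseIndex g h m g≈h = begin
    sumR (applyUpTo g m)                         ≡⟨ cong sumR (≡.sym (map-upTo g m)) ⟩
    sumR (map g (upTo m))                        ≈⟨ sumR-map-cong (applyUpTo⁺₁ (λ i → i) m g≈h) ⟩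
    sumR (map (λ i → h (m ∸ suc i)) (upTo m))    ≡⟨ cong sumR (≡.trans (map-upTo _ m) (applyUpTo-reverseIndex h m)) ⟩
    sumR (applyDownFrom h m)                     ≡⟨ cong sumR (≡.sym (reverse-applyUpTo h m)) ⟩
    sumR (reverse (applyUpTo h m))               ≈⟨ sumR-reverse (applyUpTo h m) ⟩
    sumR (applyUpTo h m)                         ∎

  guard : Bool → Carrier → Carrier
  guard p x = if p then x else 0#

  guard-cong : ∀ p {x y} → x ≈ y → guard p x ≈ guard p y
  guard-cong true  x≈y = x≈y
  guard-cong false _   = refl

  guard-*ˡ : ∀ p s x → guard p (s * x) ≈ s * guard p x
  guard-*ˡ true  s x = refl
  guard-*ˡ false s x = sym (zeroʳ s)

  guard-difference-swap : ∀ p q s {x y x′ y′} → x ≈ s * x′ → y ≈ s * y′ →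
                          guard q x - guard p y ≈ (- s) * (guard p y′ - guard q x′)
  guard-difference-swap p q s {x} {y} {x′} {y′} x≈sx′ y≈sy′ = begin
    guard q x - guard p y
      ≈⟨ +-cong (scale q x≈sx′) (-‿cong (scale p y≈sy′)) ⟩
    s * guard q x′ - s * guard p y′
      ≈⟨ sym (x[y-z]≈xy-xz s _ _) ⟩
    s * (guard q x′ - guard p y′)
      ≈⟨ *-cong refl (sym (⁻¹-anti-homo‿- _ _)) ⟩
    s * - (guard p y′ - guard q x′)
      ≈⟨ sym (-‿distribʳ-* s _) ⟩
    - (s * (guard p y′ - guard q x′))
      ≈⟨ -‿distribˡ-* s _ ⟩
    (- s) * (guard p y′ - guard q x′) ∎
    where
    scale : ∀ r {z z′} → z ≈ s * z′ → guard r z ≈ s * guard r z′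
    scale r {z′ = z′} z≈sz′ = trans (guard-cong r z≈sz′) (guard-*ˡ r s z′)

  factor-signs : ∀ α β s t {x y x̄ ȳ} → x̄ ≈ s * x → ȳ ≈ t * y →
                 α * β * (x̄ * ȳ) ≈ (s * t) * (β * α * (y * x))
  factor-signs α β s t {x} {y} {x̄} {ȳ} x̄≈sx ȳ≈ty = begin
    α * β * (x̄ * ȳ)             ≈⟨ *-cong refl (*-cong x̄≈sx ȳ≈ty) ⟩
    α * β * ((s * x) * (t * y)) ≈⟨ solve 6 (λ α β s t x y →
                                     (α ⊕ β) ⊕ ((s ⊕ x) ⊕ (t ⊕ y)) ⊜ (s ⊕ t) ⊕ ((β ⊕ α) ⊕ (y ⊕ x))) refl α β s t x y ⟩
    (s * t) * (β * α * (y * x)) ∎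

  -- The summand of B(G₁ + aX₊, G₁ + bX₊) for γ = uv, |u| = k; with u, v the split of w at k
  -- this is definitionally the summand `term k` in the definition of cF.
  contribution : ℕ → ℕ → ℕ → List ℕ → List ℕ → Carrier
  contribution f n k u v =
      guard (mem 1 u ∧ mem n v) (weight a k * weight b (n ∸ k) * (cF f (std u) * cF f (std v)))
    - guard (mem 1 v ∧ mem n u) (weight b k * weight a (n ∸ k) * (cF f (std u) * cF f (std v)))

  splitContribution : ℕ → ℕ → List ℕ → ℕ → Carrier
  splitContribution f n w k = contribution f n k (take k w) (drop k w)

  cF-unfold : ∀ f w m → length w ≡ suc (suc m) →
              cF (suc f) w ≡ sumR (applyUpTo (λ i → splitContribution f (suc (suc m)) w (suc i)) (suc m))
  cF-unfold f (_ ∷ _ ∷ _) m ≡.refl = cong sumR (≡.trans (≡.sym (map-∘ (upTo (suc m)))) (map-upTo _ (suc m)))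

  ReversalSign : ℕ → Set ℓ
  ReversalSign f = ∀ w → cF f (reverse w) ≈ sgn (length w ∸ 1) * cF f w

  contribution-reverse : ∀ {f} → ReversalSign f → ∀ {n k j u v} →
                         k ℕ.+ j ≡ n → length v ≡ k → length u ≡ j →
                         contribution f n k (reverse v) (reverse u)
                           ≈ (- (sgn (k ∸ 1) * sgn (j ∸ 1))) * contribution f n j u v
  contribution-reverse {f} ih {u = u} {v} ≡.refl ≡.refl ≡.refl
    rewrite mem-reverse 1 u | mem-reverse 1 v
          | mem-reverse (length v ℕ.+ length u) u | mem-reverse (length v ℕ.+ length u) v
          | std-reverse u | std-reverse v
          | m+n∸m≡n (length v) (length u) | m+n∸n≡m (length v) (length u)
    = guard-difference-swap _ _ _ (factor-signs _ _ _ _ (ih-std v) (ih-std u))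
                                  (factor-signs _ _ _ _ (ih-std v) (ih-std u))
    where
    ih-std : ∀ x → cF f (reverse (std x)) ≈ sgn (length x ∸ 1) * cF f (std x)
    ih-std x = subst (λ l → cF f (reverse (std x)) ≈ sgn (l ∸ 1) * cF f (std x)) (length-map _ x) (ih (std x))

  splitContribution-reverse : ∀ {f} → ReversalSign f → ∀ w k j → suc k ℕ.+ suc j ≡ length w →
                              splitContribution f (length w) (reverse w) (suc k)
                                ≈ sgn (k ℕ.+ suc j) * splitContribution f (length w) w (suc j)
  splitContribution-reverse {f} ih w k j e = begin
    contribution f n (suc k) (take (suc k) (reverse w)) (drop (suc k) (reverse w))
      ≡⟨ cong₂ (contribution f n (suc k)) (take-reverse w (suc k) (suc j) e) (drop-reverse w (suc k) (suc j) e) ⟩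
    contribution f n (suc k) (reverse (drop (suc j) w)) (reverse (take (suc j) w))
      ≈⟨ contribution-reverse {f} ih e (length-drop-split w (suc k) (suc j) e) (length-take-split w (suc k) (suc j) e) ⟩
    (- (sgn k * sgn j)) * splitContribution f n w (suc j)
      ≈⟨ *-cong (sym (sgn-+-suc k j)) refl ⟩
    sgn (k ℕ.+ suc j) * splitContribution f n w (suc j) ∎
    where n = length w

  cF-reverse : ∀ f → ReversalSign f
  cF-reverse zero          w        = sym (zeroʳ _)
  cF-reverse (suc f)       []       = sym (zeroʳ _)
  cF-reverse (suc f)       (_ ∷ []) = sym (*-identityˡ 1#)
  cF-reverse (suc f) w@(_ ∷ _ ∷ ws) = begin
    cF (suc f) (reverse w)
      ≡⟨ cF-unfold f (reverse w) (length ws) (length-reverse w) ⟩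
    sumR (applyUpTo (term (reverse w)) m)
      ≈⟨ sumR-applyUpTo-reverseIndex _ (λ i → sgn m * term w i) m termwise ⟩
    sumR (applyUpTo (λ i → sgn m * term w i) m)
      ≡⟨ cong sumR (≡.sym (map-applyUpTo (term w) (sgn m *_) m)) ⟩
    sumR (map (sgn m *_) (applyUpTo (term w) m))
      ≈⟨ sym (*-distribˡ-sumR (sgn m) (applyUpTo (term w) m)) ⟩
    sgn m * sumR (applyUpTo (term w) m)
      ≡⟨ cong (sgn m *_) (≡.sym (cF-unfold f w (length ws) ≡.refl)) ⟩
    sgn m * cF (suc f) w ∎
    where
    m = suc (length ws)
    term : List ℕ → ℕ → Carrier
    term x i = splitContribution f (suc m) x (suc i)
    termwise : ∀ {i} → i < m → term (reverse w) i ≈ sgn m * term w (m ∸ suc i)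
    termwise {i} i<m = subst (λ l → term (reverse w) i ≈ sgn l * term w (m ∸ suc i)) i+[m∸i]≡m
                             (splitContribution-reverse {f} (cF-reverse f) w i (m ∸ suc i) (cong suc i+[m∸i]≡m))
      where
      i+[m∸i]≡m : i ℕ.+ suc (m ∸ suc i) ≡ m
      i+[m∸i]≡m = ≡.trans (+-suc i (m ∸ suc i)) (m+[n∸m]≡n i<m)

  coeff-reverse : ∀ w → coeff (reverse w) ≈ sgn (length w ∸ 1) * coeff w
  coeff-reverse w rewrite length-reverse w = cF-reverse (length w) w

length-word : ∀ {n} (σ : Permutation′ n) → length (word σ) ≡ n
length-word {n} σ = ≡.trans (length-map _ (allFin n)) (length-tabulate _)

mainTheorem6 : ∀ {c ℓ} (R : CommutativeRing c ℓ) (a b : CommutativeRing.Carrier R)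
                 (n : ℕ) (σ : Permutation′ (suc n)) →
                 CommutativeRing._≈_ R (Coeffs.coeff R a b (word σ))
                   (CommutativeRing._*_ R (Coeffs.sgn R a b n) (Coeffs.coeff R a b (reverse (word σ))))
mainTheorem6 R a b n σ =
  subst₂ (λ w l → coeff w ≈ sgn (l ∸ 1) * coeff (reverse (word σ)))
         (reverse-involutive (word σ))
         (≡.trans (length-reverse (word σ)) (length-word σ))
         (coeff-reverse R a b (reverse (word σ)))
  where
  open CommutativeRing R
  open Coeffs R a b
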